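{- Consider the parameterized system $\mathcal{ME}=(Q,T)$ with $Q=\{green, black, blue, red\}$ and transition rules $\forall_{LR}\{green,black\}: green\to black$; $black\to blue$; $\exists_L\{black,blue,red\}: blue\to blue$; $\forall_L\{green\}: blue\to red$; $red\to black$; $black\to green$, with initial configurations $green^{*}$. Let $\Phi_{\mathcal P}$ be the set of universal closures of the following first-order formulae (vocabulary: constants $green, black, blue, red, e$, binary function symbol $*$, unary predicates $R, G, GB$): $(x*y)*z=x*(y*z)$; $e*x=x$; $x*e=x$; $G(e)$; $G(x)\to G(x*green)$; $GB(e)$; $GB(x)\to GB(x*green)$; $GB(x)\to GB(x*black)$; $G(x)\to R(x)$; $(R((x*green)*y)\wedge GB(x)\wedge GB(y))\to R((x*black)*y)$; $R((x*black)*y)\to R((x*blue)*y)$; $R((x*blue)*y)\wedge x=(z*black)*w\to R((x*blue)*y)$; $R((x*blue)*y)\wedge x=(z*blue)*w\to R((x*blue)*y)$; $R((x*blue)*y)\wedge x=(z*red)*w\to R((x*blue)*y)$; $R((x*blue)*y)\wedge G(x)\to R((x*red)*y)$; $R((x*red)*y)\to R((x*black)*y)$; $R((x*black)*y)\to R((x*green)*y)$. If a configuration $\bar c$ is reachable in $\mathcal{ME}$ (i.e. $\bar c_0\to^{*}\bar c$ for some $\bar c_0\in green^{*}$), then $\Phi_{\mathcal P}\vdash R(t_{\bar c})$.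
   Context: A parameterized system is a pair $(Q,T)$ of a finite set $Q$ of local states and a finite set $T$ of rules of the form $q\to q'$ or $\mathcal G: q\to q'$, with $\mathcal G$ a condition $\forall_I J$ or $\exists_I J$, $J\subseteq Q$, $I\in\{L,R,LR\}$. A configuration is a word $\bar c=c_1\cdots c_n\in Q^*$. For a position $i$: $(\bar c,i)\models\forall_L J$ iff $c_k\in J$ for all $k<i$; $(\bar c,i)\models\forall_R J$ iff $c_k\in J$ for all $k>i$; $\forall_{LR}J$ iff both; $(\bar c,i)\models\exists_L J$ iff $c_k\in J$ for some $k<i$; $\exists_R J$ iff $c_k\in J$ for some $k>i$; $\exists_{LR}J$ iff $\exists_L J$ or $\exists_R J$. One step $\bar c\to\bar c'$ holds iff for some position $i$ and some rule $q\to q'$ in $T$, or some rule $\mathcal G:q\to q'$ in $T$ with $(\bar c,i)\models\mathcal G$, we have $c_i=q$, $c'_i=q'$ and $c'_j=c_j$ for all $j\neq i$ (same length). The term translation of $\bar c=c_1\cdots c_n$ is $t_{\bar c}=c_1*\cdots*c_n$ (well defined modulo associativity; $t$ of the empty word is $e$). $\vdash$ is derivability in first-order logic with equality. -}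

module Defs where

open import Data.Nat using (ℕ; zero; suc)
open import Data.Fin using (Fin; zero; suc)
open import Data.List using (List; []; _∷_; _++_; map)
open import Data.List.Membership.Propositional using (_∈_)
open import Data.List.Relation.Unary.All using (All)
open import Data.List.Relation.Unary.Any using (Any)
open import Data.Maybe using (Maybe; just; nothing)
open import Data.Product using (Σ; _×_; _,_)
open import Data.Sum using (_⊎_)
open import Data.Unit using (⊤)
open import Relation.Binary.PropositionalEquality using (_≡_)
open import Relation.Binary.Construct.Closure.ReflexiveTransitive using (Star)

data Side : Set where
  sideL sideR sideLR : Side

data Guard (Q : Set) : Set where
  ∀g : Side → List Q → Guard Q
  ∃g : Side → List Q → Guard Q

record Rule (Q : Set) : Set where
  constructor rule
  field
    guard : Maybe (Guard Q)
    from  : Q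
    to    : Q
open Rule public

-- (c̄, i) ⊨ G, where c̄ = l ++ c_i ∷ r  (l = cells left of i, r = cells right of i)
SatGuard : {Q : Set} → Guard Q → List Q → List Q → Set
SatGuard (∀g sideL  J) l r = All (_∈ J) l
SatGuard (∀g sideR  J) l r = All (_∈ J) r
SatGuard (∀g sideLR J) l r = All (_∈ J) l × All (_∈ J) r
SatGuard (∃g sideL  J) l r = Any (_∈ J) l
SatGuard (∃g sideR  J) l r = Any (_∈ J) r
SatGuard (∃g sideLR J) l r = Any (_∈ J) l ⊎ Any (_∈ J) r

SatRuleGuard : {Q : Set} → Maybe (Guard Q) → List Q → List Q → Set
SatRuleGuard nothing  l r = ⊤
SatRuleGuard (just g) l r = SatGuard g l r

data Step {Q : Set} (T : List (Rule Q)) : List Q → List Q → Set where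
  step : (ρ : Rule Q) (l r : List Q) → ρ ∈ T → SatRuleGuard (guard ρ) l r →
         Step T (l ++ from ρ ∷ r) (l ++ to ρ ∷ r)

Reachable : {Q : Set} → List (Rule Q) → (List Q → Set) → List Q → Set
Reachable {Q} T Init c = Σ (List Q) λ c₀ → Init c₀ × Star (Step T) c₀ c

data Col : Set where
  green black blue red : Col

ME-rules : List (Rule Col)
ME-rules =
    rule (just (∀g sideLR (green ∷ black ∷ []))) green black
  ∷ rule nothing black blue
  ∷ rule (just (∃g sideL (black ∷ blue ∷ red ∷ []))) blue blue
  ∷ rule (just (∀g sideL (green ∷ []))) blue red
  ∷ rule nothing red black
  ∷ rule nothing black green
  ∷ []

ME-init : List Col → Set
ME-init c = All (_≡ green) c

-- Terms/formulas with n free variables (de Bruijn, var zero = innermost binder).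

data PredSym : Set where
  Rp Gp GBp : PredSym

infixl 9 _⊛_
data Term (n : ℕ) : Set where
  var : Fin n → Term n
  col : Col → Term n
  e   : Term n
  _⊛_ : Term n → Term n → Term n

infixr 4 _⇒_
infixr 5 _∨'_
infixr 6 _∧'_
infix 7 _≐_
data Formula (n : ℕ) : Set where
  ⊥'   : Formula n
  atom : PredSym → Term n → Formula n
  _≐_  : Term n → Term n → Formula n
  _⇒_  : Formula n → Formula n → Formula n
  _∧'_ : Formula n → Formula n → Formula n
  _∨'_ : Formula n → Formula n → Formula n
  ∀'   : Formula (suc n) → Formula n
  ∃'   : Formula (suc n) → Formula n

renT : {m n : ℕ} → (Fin m → Fin n) → Term m → Term n
renT ρ (var i) = var (ρ i)
renT ρ (col c) = col c
renT ρ e = e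
renT ρ (s ⊛ t) = renT ρ s ⊛ renT ρ t

substT : {m n : ℕ} → (Fin m → Term n) → Term m → Term n
substT σ (var i) = σ i
substT σ (col c) = col c
substT σ e = e
substT σ (s ⊛ t) = substT σ s ⊛ substT σ t

liftS : {m n : ℕ} → (Fin m → Term n) → Fin (suc m) → Term (suc n)
liftS σ zero = var zero
liftS σ (suc i) = renT suc (σ i)

substF : {m n : ℕ} → (Fin m → Term n) → Formula m → Formula n
substF σ ⊥' = ⊥'
substF σ (atom p t) = atom p (substT σ t)
substF σ (s ≐ t) = substT σ s ≐ substT σ t
substF σ (φ ⇒ ψ) = substF σ φ ⇒ substF σ ψ
substF σ (φ ∧' ψ) = substF σ φ ∧' substF σ ψ
substF σ (φ ∨' ψ) = substF σ φ ∨' substF σ ψ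
substF σ (∀' φ) = ∀' (substF (liftS σ) φ)
substF σ (∃' φ) = ∃' (substF (liftS σ) φ)

wk : {n : ℕ} → Formula n → Formula (suc n)
wk = substF (λ i → var (suc i))

single : {n : ℕ} → Term n → Fin (suc n) → Term n
single t zero = t
single t (suc i) = var i

_[_] : {n : ℕ} → Formula (suc n) → Term n → Formula n
φ [ t ] = substF (single t) φ

infix 2 _⊢_
data _⊢_ : {n : ℕ} → List (Formula n) → Formula n → Set where
  hyp   : ∀ {n} {Γ : List (Formula n)} {φ} → φ ∈ Γ → Γ ⊢ φ
  ⊥E    : ∀ {n} {Γ : List (Formula n)} {φ} → Γ ⊢ ⊥' → Γ ⊢ φ
  raa   : ∀ {n} {Γ : List (Formula n)} {φ} → ((φ ⇒ ⊥') ∷ Γ) ⊢ ⊥' → Γ ⊢ φ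
  ⇒I    : ∀ {n} {Γ : List (Formula n)} {φ ψ} → (φ ∷ Γ) ⊢ ψ → Γ ⊢ φ ⇒ ψ
  ⇒E    : ∀ {n} {Γ : List (Formula n)} {φ ψ} → Γ ⊢ φ ⇒ ψ → Γ ⊢ φ → Γ ⊢ ψ
  ∧I    : ∀ {n} {Γ : List (Formula n)} {φ ψ} → Γ ⊢ φ → Γ ⊢ ψ → Γ ⊢ φ ∧' ψ
  ∧E₁   : ∀ {n} {Γ : List (Formula n)} {φ ψ} → Γ ⊢ φ ∧' ψ → Γ ⊢ φ
  ∧E₂   : ∀ {n} {Γ : List (Formula n)} {φ ψ} → Γ ⊢ φ ∧' ψ → Γ ⊢ ψ
  ∨I₁   : ∀ {n} {Γ : List (Formula n)} {φ ψ} → Γ ⊢ φ → Γ ⊢ φ ∨' ψ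
  ∨I₂   : ∀ {n} {Γ : List (Formula n)} {φ ψ} → Γ ⊢ ψ → Γ ⊢ φ ∨' ψ
  ∨E    : ∀ {n} {Γ : List (Formula n)} {φ ψ χ} → Γ ⊢ φ ∨' ψ →
          (φ ∷ Γ) ⊢ χ → (ψ ∷ Γ) ⊢ χ → Γ ⊢ χ
  ∀I    : ∀ {n} {Γ : List (Formula n)} {φ} → map wk Γ ⊢ φ → Γ ⊢ ∀' φ
  ∀E    : ∀ {n} {Γ : List (Formula n)} {φ} → Γ ⊢ ∀' φ → (t : Term n) → Γ ⊢ φ [ t ]
  ∃I    : ∀ {n} {Γ : List (Formula n)} {φ} → (t : Term n) → Γ ⊢ φ [ t ] → Γ ⊢ ∃' φ
  ∃E    : ∀ {n} {Γ : List (Formula n)} {φ ψ} → Γ ⊢ ∃' φ →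
          (φ ∷ map wk Γ) ⊢ wk ψ → Γ ⊢ ψ
  ≐refl : ∀ {n} {Γ : List (Formula n)} {t} → Γ ⊢ t ≐ t
  ≐subst : ∀ {n} {Γ : List (Formula n)} (φ : Formula (suc n)) {s t} →
           Γ ⊢ s ≐ t → Γ ⊢ φ [ s ] → Γ ⊢ φ [ t ]

R' G' GB' : {n : ℕ} → Term n → Formula n
R' = atom Rp
G' = atom Gp
GB' = atom GBp

gr bl bu rd : {n : ℕ} → Term n
gr = col green
bl = col black
bu = col blue
rd = col red

Φ-P : List (Formula 0)
Φ-P =
    ∀' (∀' (∀' ((x3 ⊛ y3) ⊛ z3 ≐ x3 ⊛ (y3 ⊛ z3))))
  ∷ ∀' (e ⊛ x1 ≐ x1)
  ∷ ∀' (x1 ⊛ e ≐ x1)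
  ∷ G' e
  ∷ ∀' (G' x1 ⇒ G' (x1 ⊛ gr))
  ∷ GB' e
  ∷ ∀' (GB' x1 ⇒ GB' (x1 ⊛ gr))
  ∷ ∀' (GB' x1 ⇒ GB' (x1 ⊛ bl))
  ∷ ∀' (G' x1 ⇒ R' x1)
  ∷ ∀' (∀' (R' ((x2 ⊛ gr) ⊛ y2) ∧' GB' x2 ∧' GB' y2 ⇒ R' ((x2 ⊛ bl) ⊛ y2)))
  ∷ ∀' (∀' (R' ((x2 ⊛ bl) ⊛ y2) ⇒ R' ((x2 ⊛ bu) ⊛ y2)))
  ∷ ∀' (∀' (∀' (∀' (R' ((x4 ⊛ bu) ⊛ y4) ∧' x4 ≐ (z4 ⊛ bl) ⊛ w4 ⇒ R' ((x4 ⊛ bu) ⊛ y4)))))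
  ∷ ∀' (∀' (∀' (∀' (R' ((x4 ⊛ bu) ⊛ y4) ∧' x4 ≐ (z4 ⊛ bu) ⊛ w4 ⇒ R' ((x4 ⊛ bu) ⊛ y4)))))
  ∷ ∀' (∀' (∀' (∀' (R' ((x4 ⊛ bu) ⊛ y4) ∧' x4 ≐ (z4 ⊛ rd) ⊛ w4 ⇒ R' ((x4 ⊛ bu) ⊛ y4)))))
  ∷ ∀' (∀' (R' ((x2 ⊛ bu) ⊛ y2) ∧' G' x2 ⇒ R' ((x2 ⊛ rd) ⊛ y2)))
  ∷ ∀' (∀' (R' ((x2 ⊛ rd) ⊛ y2) ⇒ R' ((x2 ⊛ bl) ⊛ y2)))
  ∷ ∀' (∀' (R' ((x2 ⊛ bl) ⊛ y2) ⇒ R' ((x2 ⊛ gr) ⊛ y2)))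
  ∷ []
  where
    x1 : Term 1
    x1 = var zero
    x2 y2 : Term 2
    x2 = var (suc zero)
    y2 = var zero
    x3 y3 z3 : Term 3
    x3 = var (suc (suc zero))
    y3 = var (suc zero)
    z3 = var zero
    x4 y4 z4 w4 : Term 4
    x4 = var (suc (suc (suc zero)))
    y4 = var (suc (suc zero))
    z4 = var (suc zero)
    w4 = var zero

-- term translation t_c̄ = c₁ * (c₂ * (⋯ * cₙ)),  t_ε = e
-- (right-bracketed representative; well defined modulo associativity)
t⟦_⟧ : List Col → Term 0
t⟦ [] ⟧ = e
t⟦ c ∷ [] ⟧ = col c
t⟦ c ∷ d ∷ cs ⟧ = col c ⊛ t⟦ d ∷ cs ⟧

module Submission where

-- The theory Φ-P is an "inductive invariant" of the system ME:
-- the initial configurations green* satisfy R, and every rule of ME has an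
-- axiom of Φ-P that transports R from t⟦c̄⟧ to t⟦c̄'⟧.  The only real work is
-- to phrase a step  l ++ q ∷ r  →  l ++ q' ∷ r  in the shape of the axioms,
-- R((x * q) * y) ⇒ R((x * q') * y), with x = t⟦l⟧ and y = t⟦r⟧.

open import Defs
open import Data.Nat using (ℕ; suc)
open import Data.Fin using (Fin; zero; suc; #_)
open import Data.List using (List; []; _∷_; _++_; lookup)
open import Data.List.Membership.Propositional using (_∈_)
open import Data.List.Membership.Propositional.Properties using (∈-lookup)
open import Data.List.Relation.Unary.All as All using (All; []; _∷_)
open import Data.List.Relation.Unary.Any using (here; there)
open import Data.Product using (_,_)
open import Relation.Binary.Bundles using (Setoid)
open import Relation.Binary.PropositionalEquality
  using (_≡_; refl; sym; trans; cong; cong₂; subst; subst₂)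
open import Relation.Binary.Construct.Closure.ReflexiveTransitive using (Star; ε; _◅_)
import Relation.Binary.Reasoning.Setoid as SetoidReasoning

substT-cong : ∀ {m n} {σ τ : Fin m → Term n} → (∀ i → σ i ≡ τ i) →
              ∀ t → substT σ t ≡ substT τ t
substT-cong h (var i) = h i
substT-cong h (col c) = refl
substT-cong h e       = refl
substT-cong h (s ⊛ t) = cong₂ _⊛_ (substT-cong h s) (substT-cong h t)

liftS-cong : ∀ {m n} {σ τ : Fin m → Term n} → (∀ i → σ i ≡ τ i) →
             ∀ i → liftS σ i ≡ liftS τ i
liftS-cong h zero    = refl
liftS-cong h (suc i) = cong (renT suc) (h i)

substF-cong : ∀ {m n} {σ τ : Fin m → Term n} → (∀ i → σ i ≡ τ i) →
              ∀ φ → substF σ φ ≡ substF τ φ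
substF-cong h ⊥'         = refl
substF-cong h (atom p t) = cong (atom p) (substT-cong h t)
substF-cong h (s ≐ t)    = cong₂ _≐_ (substT-cong h s) (substT-cong h t)
substF-cong h (φ ⇒ ψ)    = cong₂ _⇒_ (substF-cong h φ) (substF-cong h ψ)
substF-cong h (φ ∧' ψ)   = cong₂ _∧'_ (substF-cong h φ) (substF-cong h ψ)
substF-cong h (φ ∨' ψ)   = cong₂ _∨'_ (substF-cong h φ) (substF-cong h ψ)
substF-cong h (∀' φ)     = cong ∀' (substF-cong (liftS-cong h) φ)
substF-cong h (∃' φ)     = cong ∃' (substF-cong (liftS-cong h) φ)

substT-var : ∀ {n} (t : Term n) → substT var t ≡ t
substT-var (var i) = refl
substT-var (col c) = refl
substT-var e       = refl
substT-var (s ⊛ t) = cong₂ _⊛_ (substT-var s) (substT-var t)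

substT-renT : ∀ {k m n} (σ : Fin m → Term n) (ρ : Fin k → Fin m) t →
              substT σ (renT ρ t) ≡ substT (λ i → σ (ρ i)) t
substT-renT σ ρ (var i) = refl
substT-renT σ ρ (col c) = refl
substT-renT σ ρ e       = refl
substT-renT σ ρ (s ⊛ t) = cong₂ _⊛_ (substT-renT σ ρ s) (substT-renT σ ρ t)

renT-substT : ∀ {m n p} (ρ : Fin n → Fin p) (σ : Fin m → Term n) t →
              renT ρ (substT σ t) ≡ substT (λ i → renT ρ (σ i)) t
renT-substT ρ σ (var i) = refl
renT-substT ρ σ (col c) = refl
renT-substT ρ σ e       = refl
renT-substT ρ σ (s ⊛ t) = cong₂ _⊛_ (renT-substT ρ σ s) (renT-substT ρ σ t)

substT-substT : ∀ {k m n} (σ : Fin m → Term n) (τ : Fin k → Term m) t →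
                substT σ (substT τ t) ≡ substT (λ i → substT σ (τ i)) t
substT-substT σ τ (var i) = refl
substT-substT σ τ (col c) = refl
substT-substT σ τ e       = refl
substT-substT σ τ (s ⊛ t) = cong₂ _⊛_ (substT-substT σ τ s) (substT-substT σ τ t)

instantiate-weakened : ∀ {n} (u s : Term n) → substT (single u) (renT suc s) ≡ s
instantiate-weakened u s = trans (substT-renT (single u) suc s) (substT-var s)

liftS-comp : ∀ {k m n} (σ : Fin m → Term n) (τ : Fin k → Term m) i →
             substT (liftS σ) (liftS τ i) ≡ liftS (λ j → substT σ (τ j)) i
liftS-comp σ τ zero    = refl
liftS-comp σ τ (suc i) =
  trans (substT-renT (liftS σ) suc (τ i)) (sym (renT-substT suc σ (τ i)))

substF-fuse-lifted : ∀ {k m n} (σ : Fin m → Term n) (τ : Fin k → Term m) φ →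
  substF (liftS σ) (substF (liftS τ) φ) ≡ substF (liftS (λ i → substT σ (τ i))) φ

substF-fuse : ∀ {k m n} (σ : Fin m → Term n) (τ : Fin k → Term m) φ →
              substF σ (substF τ φ) ≡ substF (λ i → substT σ (τ i)) φ
substF-fuse σ τ ⊥'         = refl
substF-fuse σ τ (atom p t) = cong (atom p) (substT-substT σ τ t)
substF-fuse σ τ (s ≐ t)    = cong₂ _≐_ (substT-substT σ τ s) (substT-substT σ τ t)
substF-fuse σ τ (φ ⇒ ψ)    = cong₂ _⇒_ (substF-fuse σ τ φ) (substF-fuse σ τ ψ)
substF-fuse σ τ (φ ∧' ψ)   = cong₂ _∧'_ (substF-fuse σ τ φ) (substF-fuse σ τ ψ)
substF-fuse σ τ (φ ∨' ψ)   = cong₂ _∨'_ (substF-fuse σ τ φ) (substF-fuse σ τ ψ)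
substF-fuse σ τ (∀' φ)     = cong ∀' (substF-fuse-lifted σ τ φ)
substF-fuse σ τ (∃' φ)     = cong ∃' (substF-fuse-lifted σ τ φ)

substF-fuse-lifted σ τ φ =
  trans (substF-fuse (liftS σ) (liftS τ) φ) (substF-cong (liftS-comp σ τ) φ)

-- Simultaneous substitutions for the two / three innermost binders
-- (the last argument replaces the innermost variable).
single₂ : ∀ {n} → Term n → Term n → Fin (suc (suc n)) → Term n
single₂ a b zero    = b
single₂ a b (suc i) = single a i

single₃ : ∀ {n} → Term n → Term n → Term n → Fin (suc (suc (suc n))) → Term n
single₃ a b c zero    = c
single₃ a b c (suc i) = single₂ a b i

module Derived {n : ℕ} (Γ : List (Formula n)) where

  ∀E₂ : ∀ {ψ} → Γ ⊢ ∀' (∀' ψ) → (a b : Term n) → Γ ⊢ substF (single₂ a b) ψ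
  ∀E₂ {ψ} h a b =
    subst (Γ ⊢_) (trans (substF-fuse _ _ ψ) (substF-cong agree ψ)) (∀E (∀E h a) b)
    where
    agree : ∀ i → substT (single b) (liftS (single a) i) ≡ single₂ a b i
    agree zero    = refl
    agree (suc i) = instantiate-weakened b (single a i)

  ∀E₃ : ∀ {ψ} → Γ ⊢ ∀' (∀' (∀' ψ)) → (a b c : Term n) → Γ ⊢ substF (single₃ a b c) ψ
  ∀E₃ {ψ} h a b c =
    subst (Γ ⊢_) (trans (substF-fuse _ _ ψ) (substF-cong agree ψ)) (∀E₂ (∀E h a) b c)
    where
    agree : ∀ i → substT (single₂ b c) (liftS (liftS (single a)) i) ≡ single₃ a b c i
    agree zero          = refl
    agree (suc zero)    = refl
    agree (suc (suc i)) =
      trans (substT-renT (single₂ b c) suc (renT suc (single a i)))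
            (instantiate-weakened b (single a i))

  -- Replacing a term by a provably equal one inside a one-hole context C.
  -- (rewrite the right side of  C[s] = C[s]  along s = t).
  ≐-cong : ∀ (C : Term (suc n)) {s t} → Γ ⊢ s ≐ t →
           Γ ⊢ substT (single s) C ≐ substT (single t) C
  ≐-cong C {s} {t} s≐t =
    subst (λ X → Γ ⊢ X ≐ substT (single t) C) (instantiate-weakened t Cs)
      (≐subst (renT suc Cs ≐ C) s≐t
        (subst (λ X → Γ ⊢ X ≐ Cs) (sym (instantiate-weakened s Cs)) ≐refl))
    where
    Cs : Term n
    Cs = substT (single s) C

  -- Symmetry and transitivity follow from reflexivity and Leibniz
  -- substitution ≐subst, instantiated in the formula  x = s  resp.  s = x.
  ≐-sym : ∀ {s t} → Γ ⊢ s ≐ t → Γ ⊢ t ≐ s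
  ≐-sym {s} {t} s≐t =
    subst (λ X → Γ ⊢ t ≐ X) (instantiate-weakened t s)
      (≐subst (var zero ≐ renT suc s) s≐t
        (subst (λ X → Γ ⊢ s ≐ X) (sym (instantiate-weakened s s)) ≐refl))

  ≐-trans : ∀ {s t u} → Γ ⊢ s ≐ t → Γ ⊢ t ≐ u → Γ ⊢ s ≐ u
  ≐-trans {s} {t} {u} s≐t t≐u =
    subst (λ X → Γ ⊢ X ≐ u) (instantiate-weakened u s)
      (≐subst (renT suc s ≐ var zero) t≐u
        (subst (λ X → Γ ⊢ X ≐ t) (sym (instantiate-weakened t s)) s≐t))

  provable-≐ : Setoid _ _
  provable-≐ = record
    { Carrier       = Term n
    ; _≈_           = λ s t → Γ ⊢ s ≐ t
    ; isEquivalence = record { refl = ≐refl ; sym = ≐-sym ; trans = ≐-trans }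
    }

  ⊛-congˡ : ∀ u {s t} → Γ ⊢ s ≐ t → Γ ⊢ s ⊛ u ≐ t ⊛ u
  ⊛-congˡ u {s} {t} s≐t =
    subst₂ (λ X Y → Γ ⊢ s ⊛ X ≐ t ⊛ Y)
      (instantiate-weakened s u) (instantiate-weakened t u)
      (≐-cong (var zero ⊛ renT suc u) s≐t)

  ⊛-congʳ : ∀ u {s t} → Γ ⊢ s ≐ t → Γ ⊢ u ⊛ s ≐ u ⊛ t
  ⊛-congʳ u {s} {t} s≐t =
    subst₂ (λ X Y → Γ ⊢ X ⊛ s ≐ Y ⊛ t)
      (instantiate-weakened s u) (instantiate-weakened t u)
      (≐-cong (renT suc u ⊛ var zero) s≐t)

  atom-resp : ∀ p {s t} → Γ ⊢ s ≐ t → Γ ⊢ atom p s → Γ ⊢ atom p t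
  atom-resp p s≐t = ≐subst (atom p (var zero)) s≐t

open Derived Φ-P
open SetoidReasoning provable-≐

axiom : ∀ k → Φ-P ⊢ lookup Φ-P k
axiom k = hyp (∈-lookup k)

⊛-assoc : ∀ a b c → Φ-P ⊢ (a ⊛ b) ⊛ c ≐ a ⊛ (b ⊛ c)
⊛-assoc = ∀E₃ (axiom (# 0))

⊛-identityˡ : ∀ a → Φ-P ⊢ e ⊛ a ≐ a
⊛-identityˡ = ∀E (axiom (# 1))

⊛-identityʳ : ∀ a → Φ-P ⊢ a ⊛ e ≐ a
⊛-identityʳ = ∀E (axiom (# 2))

G-e : Φ-P ⊢ G' e
G-e = axiom (# 3)

G-green : ∀ x → Φ-P ⊢ G' x → Φ-P ⊢ G' (x ⊛ gr)
G-green x = ⇒E (∀E (axiom (# 4)) x)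

GB-e : Φ-P ⊢ GB' e
GB-e = axiom (# 5)

GB-green : ∀ x → Φ-P ⊢ GB' x → Φ-P ⊢ GB' (x ⊛ gr)
GB-green x = ⇒E (∀E (axiom (# 6)) x)

GB-black : ∀ x → Φ-P ⊢ GB' x → Φ-P ⊢ GB' (x ⊛ bl)
GB-black x = ⇒E (∀E (axiom (# 7)) x)

G⇒R : ∀ x → Φ-P ⊢ G' x → Φ-P ⊢ R' x
G⇒R x = ⇒E (∀E (axiom (# 8)) x)

green→black : ∀ x y → Φ-P ⊢ R' ((x ⊛ gr) ⊛ y) → Φ-P ⊢ GB' x → Φ-P ⊢ GB' y →
              Φ-P ⊢ R' ((x ⊛ bl) ⊛ y)
green→black x y h gx gy = ⇒E (∀E₂ (axiom (# 9)) x y) (∧I h (∧I gx gy))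

black→blue : ∀ x y → Φ-P ⊢ R' ((x ⊛ bl) ⊛ y) → Φ-P ⊢ R' ((x ⊛ bu) ⊛ y)
black→blue x y = ⇒E (∀E₂ (axiom (# 10)) x y)

blue→red : ∀ x y → Φ-P ⊢ R' ((x ⊛ bu) ⊛ y) → Φ-P ⊢ G' x → Φ-P ⊢ R' ((x ⊛ rd) ⊛ y)
blue→red x y h gx = ⇒E (∀E₂ (axiom (# 14)) x y) (∧I h gx)

red→black : ∀ x y → Φ-P ⊢ R' ((x ⊛ rd) ⊛ y) → Φ-P ⊢ R' ((x ⊛ bl) ⊛ y)
red→black x y = ⇒E (∀E₂ (axiom (# 15)) x y)

black→green : ∀ x y → Φ-P ⊢ R' ((x ⊛ bl) ⊛ y) → Φ-P ⊢ R' ((x ⊛ gr) ⊛ y)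
black→green x y = ⇒E (∀E₂ (axiom (# 16)) x y)

-- t⟦c ∷ l⟧ is c * t⟦l⟧ (syntactically so unless l is empty).
t⟦∷⟧ : ∀ c l → Φ-P ⊢ t⟦ c ∷ l ⟧ ≐ col c ⊛ t⟦ l ⟧
t⟦∷⟧ c []      = ≐-sym (⊛-identityʳ (col c))
t⟦∷⟧ c (d ∷ l) = ≐refl

t⟦++⟧ : ∀ l r → Φ-P ⊢ t⟦ l ++ r ⟧ ≐ t⟦ l ⟧ ⊛ t⟦ r ⟧
t⟦++⟧ []      r = ≐-sym (⊛-identityˡ t⟦ r ⟧)
t⟦++⟧ (c ∷ l) r = begin
  t⟦ c ∷ l ++ r ⟧            ≈⟨ t⟦∷⟧ c (l ++ r) ⟩
  col c ⊛ t⟦ l ++ r ⟧        ≈⟨ ⊛-congʳ (col c) (t⟦++⟧ l r) ⟩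
  col c ⊛ (t⟦ l ⟧ ⊛ t⟦ r ⟧)  ≈⟨ ⊛-assoc (col c) t⟦ l ⟧ t⟦ r ⟧ ⟨
  (col c ⊛ t⟦ l ⟧) ⊛ t⟦ r ⟧  ≈⟨ ⊛-congˡ t⟦ r ⟧ (t⟦∷⟧ c l) ⟨
  t⟦ c ∷ l ⟧ ⊛ t⟦ r ⟧        ∎

-- A configuration split at a cell q has the shape of the axioms' premises.
t⟦cell⟧ : ∀ l q r → Φ-P ⊢ t⟦ l ++ q ∷ r ⟧ ≐ (t⟦ l ⟧ ⊛ col q) ⊛ t⟦ r ⟧
t⟦cell⟧ l q r = begin
  t⟦ l ++ q ∷ r ⟧             ≈⟨ t⟦++⟧ l (q ∷ r) ⟩
  t⟦ l ⟧ ⊛ t⟦ q ∷ r ⟧         ≈⟨ ⊛-congʳ t⟦ l ⟧ (t⟦∷⟧ q r) ⟩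
  t⟦ l ⟧ ⊛ (col q ⊛ t⟦ r ⟧)   ≈⟨ ⊛-assoc t⟦ l ⟧ (col q) t⟦ r ⟧ ⟨
  (t⟦ l ⟧ ⊛ col q) ⊛ t⟦ r ⟧   ∎

rewrite-cell : ∀ l {q q'} r →
               (Φ-P ⊢ R' ((t⟦ l ⟧ ⊛ col q) ⊛ t⟦ r ⟧) → Φ-P ⊢ R' ((t⟦ l ⟧ ⊛ col q') ⊛ t⟦ r ⟧)) →
               Φ-P ⊢ R' t⟦ l ++ q ∷ r ⟧ → Φ-P ⊢ R' t⟦ l ++ q' ∷ r ⟧
rewrite-cell l {q} {q'} r local-step h =
  atom-resp Rp (≐-sym (t⟦cell⟧ l q' r)) (local-step (atom-resp Rp (t⟦cell⟧ l q r) h))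

word-closure : ∀ p (J : List Col) → Φ-P ⊢ atom p e →
               (∀ x {c} → c ∈ J → Φ-P ⊢ atom p x → Φ-P ⊢ atom p (x ⊛ col c)) →
               ∀ l → All (_∈ J) l → Φ-P ⊢ atom p t⟦ l ⟧
word-closure p J base extend l l∈J* =
  atom-resp p (⊛-identityˡ t⟦ l ⟧) (append e l l∈J* base)
  where
  append : ∀ x l → All (_∈ J) l → Φ-P ⊢ atom p x → Φ-P ⊢ atom p (x ⊛ t⟦ l ⟧)
  append x []      []          px = atom-resp p (≐-sym (⊛-identityʳ x)) px
  append x (c ∷ l) (c∈J ∷ l∈J) px = atom-resp p shift (append (x ⊛ col c) l l∈J (extend x c∈J px))
    where
    shift : Φ-P ⊢ (x ⊛ col c) ⊛ t⟦ l ⟧ ≐ x ⊛ t⟦ c ∷ l ⟧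
    shift = ≐-trans (⊛-assoc x (col c) t⟦ l ⟧) (⊛-congʳ x (≐-sym (t⟦∷⟧ c l)))

G-green* : ∀ l → All (_∈ green ∷ []) l → Φ-P ⊢ G' t⟦ l ⟧
G-green* = word-closure Gp (green ∷ []) G-e extend
  where
  extend : ∀ x {c} → c ∈ green ∷ [] → Φ-P ⊢ G' x → Φ-P ⊢ G' (x ⊛ col c)
  extend x (here refl) = G-green x

GB-greenblack* : ∀ l → All (_∈ green ∷ black ∷ []) l → Φ-P ⊢ GB' t⟦ l ⟧
GB-greenblack* = word-closure GBp (green ∷ black ∷ []) GB-e extend
  where
  extend : ∀ x {c} → c ∈ green ∷ black ∷ [] → Φ-P ⊢ GB' x → Φ-P ⊢ GB' (x ⊛ col c)
  extend x (here refl)         = GB-green x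
  extend x (there (here refl)) = GB-black x

-- Every step of ME preserves derivability of R.  The guarded self-loop
-- blue → blue leaves the configuration unchanged.
step-preserves-R : ∀ {c c'} → Step ME-rules c c' → Φ-P ⊢ R' t⟦ c ⟧ → Φ-P ⊢ R' t⟦ c' ⟧
step-preserves-R (step _ l r (here refl) (l∈gb* , r∈gb*)) =
  rewrite-cell l r λ h →
    green→black t⟦ l ⟧ t⟦ r ⟧ h (GB-greenblack* l l∈gb*) (GB-greenblack* r r∈gb*)
step-preserves-R (step _ l r (there (here refl)) _) =
  rewrite-cell l r (black→blue t⟦ l ⟧ t⟦ r ⟧)
step-preserves-R (step _ l r (there (there (here refl))) _) h = h
step-preserves-R (step _ l r (there (there (there (here refl)))) l∈g*) =
  rewrite-cell l r λ h → blue→red t⟦ l ⟧ t⟦ r ⟧ h (G-green* l l∈g*)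
step-preserves-R (step _ l r (there (there (there (there (here refl))))) _) =
  rewrite-cell l r (red→black t⟦ l ⟧ t⟦ r ⟧)
step-preserves-R (step _ l r (there (there (there (there (there (here refl)))))) _) =
  rewrite-cell l r (black→green t⟦ l ⟧ t⟦ r ⟧)
step-preserves-R (step _ l r (there (there (there (there (there (there ())))))) _)

run-preserves-R : ∀ {c c'} → Star (Step ME-rules) c c' → Φ-P ⊢ R' t⟦ c ⟧ → Φ-P ⊢ R' t⟦ c' ⟧
run-preserves-R ε        h = h
run-preserves-R (s ◅ ss) h = run-preserves-R ss (step-preserves-R s h)

initial-R : ∀ c → ME-init c → Φ-P ⊢ R' t⟦ c ⟧
initial-R c c∈green* = G⇒R t⟦ c ⟧ (G-green* c (All.map here c∈green*))

proposition1 : (c : List Col) → Reachable ME-rules ME-init c → Φ-P ⊢ R' t⟦ c ⟧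
proposition1 c (c₀ , c₀-initial , run) = run-preserves-R run (initial-R c₀ c₀-initial)
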